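{- Let $k>1$ be an integer. Then there is an admissible set $\mathcal H=\{h_1,\ldots,h_k\}$ of integers with $h_1=0<h_2<\cdots<h_k$ having the following properties: (i) all of $h_1,h_2,\ldots,h_k$ are multiples of $K=4\prod_{p<4k}p$ (product over primes $p<4k$); (ii) for each $1\leqslant i<j\leqslant k$, the number $h_i-h_j$ has a prime divisor $p>4k$ with $h_i\not\equiv h_j\pmod{p^2}$; (iii) if $1\leqslant i<j\leqslant k$, $1\leqslant s<t\leqslant k$ and $\{i,j\}\neq\{s,t\}$, then no prime $p>4k$ divides both $h_i-h_j$ and $h_s-h_t$.
   Context: A finite set $\{h_1,\ldots,h_k\}$ of distinct integers is called admissible if for every prime $p$ the union of residue classes $\bigcup_{i=1}^k (h_i+p\mathbb Z)$ is not all of $\mathbb Z$. Throughout, $p$ denotes a prime. -}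

module Defs where

open import Data.Nat using (ℕ; zero; suc; _*_)
open import Data.Nat.Primality using (Prime; prime?)
open import Data.Bool using (if_then_else_)
open import Relation.Nullary using (does; ¬_)
open import Data.Fin using (Fin)
open import Data.Product using (∃)
open import Data.Integer as ℤ using (ℤ; +_)
open import Data.Integer.Divisibility using (_∣_)

primeProductBelow : ℕ → ℕ
primeProductBelow zero = 1
primeProductBelow (suc n) =
  if does (prime? n) then n * primeProductBelow n else primeProductBelow n

Admissible : {k : ℕ} → (Fin k → ℤ) → Set
Admissible {k} h = ∀ (p : ℕ) → Prime p →
  ∃ λ (n : ℤ) → ∀ (i : Fin k) → ¬ ((+ p) ∣ (n ℤ.- h i))

-- Put h_i = K z_i with K = 4 ∏_{p<4k} p, z_0 = 0 and
-- z_{n+1} = (n+1) + P (1 + L t),  where B = z_n + 4k + 3, P = (B!)², L = ∏_{p ≤ P+B} p.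
-- For l ≤ n the number D = (n+1) − z_l is a nonzero divisor of B!, so D + P = D (1 + e B!)
-- has a prime factor q > B.  Then q ∣ L, hence q divides z_{n+1} − z_l for every t, while
-- q² divides it for at most one t ≤ n+1, because L is squarefree.  By pigeonhole some
-- t ≤ n+1 makes every difference z_{n+1} − z_l exactly divisible by a prime > B: this is (ii).
-- For (iii) fix a prime p > 4k.  Whenever p ≤ B we have z_{n+1} ≡ n+1 (mod p), so the
-- indices i with z_i < p or z_i ≡ i (mod p) have pairwise distinct residues, and at most one
-- index has neither property.  Every pair with p ∣ h_i − h_j contains that exceptional index,
-- and its other member is determined by its residue, so two such pairs coincide.
-- Admissibility: primes p ≤ k divide every h_i, and for p > k the k numbers h_i miss one of
-- the residues 0, …, k.

module Submission where

module Construction where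

  open import Defs
  open import Data.Empty using (⊥; ⊥-elim)
  open import Data.Fin as Fin using (Fin; toℕ)
  import Data.Fin.Properties as Fin
  open import Data.Integer as ℤ using (ℤ; +_; 0ℤ; 1ℤ)
  open import Data.Integer.Divisibility.Signed as ℤ∣ using () renaming (_∣_ to _∣ℤ_)
  import Data.Integer.Properties as ℤ
  import Data.Integer.Tactic.RingSolver as ℤ-Ring
  open import Data.List using ([]; _∷_)
  open import Data.List.Relation.Unary.All using (_∷_)
  open import Data.Nat as ℕ using (ℕ; zero; suc; _+_; _*_; _^_; _!; _≤_; _<_; z≤n; s≤s; z<s; NonZero)
  open import Data.Nat.Divisibility
    using ( _∣_; divides; _∣?_; _∣0; ∣-trans; m∣m*n; ∣n⇒∣m*n; *-cancelˡ-∣; *-monoˡ-∣; ∣⇒≤; ∣1⇒≡1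
          ; m≤n⇒m!∣n!)
  open import Data.Nat.ListAction using (product)
  open import Data.Nat.Primality
    using (Prime; prime?; euclidsLemma; prime⇒nonZero; prime⇒nonTrivial; prime⇒irreducible)
  open import Data.Nat.Primality.Factorisation using (factorise)
  open import Data.Nat.Properties as ℕ
    using ( _≟_; ≤-refl; ≤-trans; <-trans; <-≤-trans; ≤-<-trans; <⇒≤; <⇒≱; <-irrefl
          ; m<n⇒m<1+n; m<1+n⇒m<n∨m≡n; _!≢0)
  open import Data.Nat.Tactic.RingSolver using (solve-∀)
  open import Data.Product using (∃; _×_; _,_; proj₁; proj₂; map₂)
  open import Data.Sum using (_⊎_; inj₁; inj₂)
  open import Function using (_∘_)
  open import Relation.Binary.Definitions using (tri<; tri≈; tri>)
  open import Relation.Binary.PropositionalEquality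
    using (_≡_; _≢_; refl; sym; trans; cong; cong₂; subst; subst₂; module ≡-Reasoning)
  open import Relation.Nullary using (¬_; Dec; yes; no)
  open import Relation.Nullary.Decidable using (map′; _×-dec_; _⊎-dec_; ¬?; decidable-stable)

  -- Primes, factorials and primorials

  prime>1 : ∀ {p} → Prime p → 1 < p
  prime>1 {p} pp = ℕ.nonTrivial⇒n>1 p {{prime⇒nonTrivial pp}}

  prime∤1 : ∀ {p} → Prime p → ¬ p ∣ 1
  prime∤1 pp p∣1 = <-irrefl (sym (∣1⇒≡1 p∣1)) (prime>1 pp)

  prime∣prime⇒≡ : ∀ {q p} → Prime q → Prime p → q ∣ p → q ≡ p
  prime∣prime⇒≡ pq pp q∣p with prime⇒irreducible pp q∣p
  ... | inj₁ refl = ⊥-elim (<-irrefl refl (prime>1 pq))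
  ... | inj₂ q≡p = q≡p

  ∃-prime-factor : ∀ {n} → 1 < n → ∃ λ q → Prime q × q ∣ n
  ∃-prime-factor {suc zero} (s≤s ())
  ∃-prime-factor {suc (suc n)} _ with factorise (suc (suc n))
  ... | record { factors = [] ; isFactorisation = () }
  ... | record { factors = q ∷ qs ; isFactorisation = eq ; factorsPrime = pq ∷ _ } =
    q , pq , subst (q ∣_) (sym eq) (m∣m*n (product qs))

  ∣n! : ∀ {q n} → 0 < q → q ≤ n → q ∣ n !
  ∣n! {suc q} _ q≤n = ∣-trans (m∣m*n (q !)) (m≤n⇒m!∣n! q≤n)

  n≤n! : ∀ n → n ≤ n !
  n≤n! zero    = z≤n
  n≤n! (suc n) = ℕ.m≤m*n (suc n) (n !) {{n !≢0}}

  prime∣n!⇒≤ : ∀ {q} n → Prime q → q ∣ n ! → q ≤ n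
  prime∣n!⇒≤ zero    pq q∣1 = ⊥-elim (prime∤1 pq q∣1)
  prime∣n!⇒≤ (suc n) pq q∣n! with euclidsLemma (suc n) (n !) pq q∣n!
  ... | inj₁ q∣1+n = ∣⇒≤ q∣1+n
  ... | inj₂ q∣n!  = ℕ.m≤n⇒m≤1+n (prime∣n!⇒≤ n pq q∣n!)

  prime²∣m*n⇒prime²∣n : ∀ {q} m n → Prime q → ¬ q ∣ m → q * q ∣ m * n → q * q ∣ n
  prime²∣m*n⇒prime²∣n {q} m n pq q∤m q²∣mn with euclidsLemma m n pq (∣-trans (m∣m*n q) q²∣mn)
  ... | inj₁ q∣m = ⊥-elim (q∤m q∣m)
  ... | inj₂ (divides n′ refl) = *-monoˡ-∣ q q∣n′
    where
    instance _ = prime⇒nonZero pq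
    rearrange : ∀ m n q → m * (n * q) ≡ q * (m * n)
    rearrange = solve-∀
    q∣n′ : q ∣ n′
    q∣n′ with euclidsLemma m n′ pq (*-cancelˡ-∣ q (subst (q * q ∣_) (rearrange m n′ q) q²∣mn))
    ... | inj₁ q∣m = ⊥-elim (q∤m q∣m)
    ... | inj₂ q∣n′ = q∣n′

  primeProductBelow>0 : ∀ n → 0 < primeProductBelow n
  primeProductBelow>0 zero = s≤s z≤n
  primeProductBelow>0 (suc n) with prime? n
  ... | yes pn = ℕ.*-mono-≤ (<⇒≤ (prime>1 pn)) (primeProductBelow>0 n)
  ... | no _   = primeProductBelow>0 n

  ∣primeProductBelow : ∀ {q} n → Prime q → q < n → q ∣ primeProductBelow n
  ∣primeProductBelow {q} (suc n) pq q<1+n with prime? n | m<1+n⇒m<n∨m≡n q<1+n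
  ... | yes _ | inj₁ q<n  = ∣n⇒∣m*n n (∣primeProductBelow n pq q<n)
  ... | yes _ | inj₂ refl = m∣m*n (primeProductBelow q)
  ... | no _  | inj₁ q<n  = ∣primeProductBelow n pq q<n
  ... | no ¬pn | inj₂ refl = ⊥-elim (¬pn pq)

  prime∣primeProductBelow⇒< : ∀ {q} n → Prime q → q ∣ primeProductBelow n → q < n
  prime∣primeProductBelow⇒< zero pq q∣1 = ⊥-elim (prime∤1 pq q∣1)
  prime∣primeProductBelow⇒< (suc n) pq q∣∏ with prime? n
  ... | no _ = m<n⇒m<1+n (prime∣primeProductBelow⇒< n pq q∣∏)
  ... | yes pn with euclidsLemma n (primeProductBelow n) pq q∣∏
  ...   | inj₁ q∣n = s≤s (ℕ.≤-reflexive (prime∣prime⇒≡ pq pn q∣n))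
  ...   | inj₂ q∣∏ = m<n⇒m<1+n (prime∣primeProductBelow⇒< n pq q∣∏)

  primeProductBelow-squarefree : ∀ {q} n → Prime q → ¬ q * q ∣ primeProductBelow n
  primeProductBelow-squarefree zero pq q²∣1 = prime∤1 pq (∣-trans (m∣m*n _) q²∣1)
  primeProductBelow-squarefree {q} (suc n) pq q²∣∏ with prime? n
  ... | no _ = primeProductBelow-squarefree n pq q²∣∏
  ... | yes pn with q ≟ n
  ...   | no q≢n = primeProductBelow-squarefree n pq
                     (prime²∣m*n⇒prime²∣n n _ pq (q≢n ∘ prime∣prime⇒≡ pq pn) q²∣∏)
  ...   | yes refl = <-irrefl refl
                     (prime∣primeProductBelow⇒< q pq (*-cancelˡ-∣ q {{prime⇒nonZero pq}} q²∣∏))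

  ∣⇒≡0 : ∀ {p n} → p ∣ n → n < p → n ≡ 0
  ∣⇒≡0 {n = zero}  _   _   = refl
  ∣⇒≡0 {n = suc _} p∣n n<p = ⊥-elim (<⇒≱ n<p (∣⇒≤ p∣n))

  ∣+m-+n∣≤m⊔n : ∀ m n → ℤ.∣ + m ℤ.- + n ∣ ≤ m ℕ.⊔ n
  ∣+m-+n∣≤m⊔n m n =
    subst (_≤ m ℕ.⊔ n) (cong ℤ.∣_∣ (sym (ℤ.[+m]-[+n]≡m⊖n m n))) (ℤ.∣m⊝n∣≤m⊔n m n)

  +[m+n]-+m : ∀ m n → + (m + n) ℤ.- + m ≡ + n
  +[m+n]-+m m n = trans (cong (ℤ._- + m) (ℤ.pos-+ m n)) (cancel (+ m) (+ n))
    where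
    cancel : ∀ a b → (a ℤ.+ b) ℤ.- a ≡ b
    cancel = ℤ-Ring.solve-∀

  ∣+[k*a]-+[k*b]∣ : ∀ k a b → ℤ.∣ + (k * a) ℤ.- + (k * b) ∣ ≡ k * ℤ.∣ + b ℤ.- + a ∣
  ∣+[k*a]-+[k*b]∣ k a b = begin
    ℤ.∣ + (k * a) ℤ.- + (k * b) ∣      ≡⟨ cong₂ (λ x y → ℤ.∣ x ℤ.- y ∣) (ℤ.pos-* k a) (ℤ.pos-* k b) ⟩
    ℤ.∣ + k ℤ.* + a ℤ.- + k ℤ.* + b ∣  ≡⟨ cong ℤ.∣_∣ (factor (+ k) (+ a) (+ b)) ⟩
    ℤ.∣ + k ℤ.* (+ a ℤ.- + b) ∣        ≡⟨ ℤ.abs-* (+ k) _ ⟩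
    k * ℤ.∣ + a ℤ.- + b ∣              ≡⟨ cong (k *_) (ℤ.∣i-j∣≡∣j-i∣ (+ a) (+ b)) ⟩
    k * ℤ.∣ + b ℤ.- + a ∣              ∎
    where
    open ≡-Reasoning
    factor : ∀ k a b → k ℤ.* a ℤ.- k ℤ.* b ≡ k ℤ.* (a ℤ.- b)
    factor = ℤ-Ring.solve-∀

  infix 4 _≡_mod_

  record _≡_mod_ (a b : ℤ) (n : ℕ) : Set where
    constructor congruent
    field
      divides-difference : + n ∣ℤ a ℤ.- b

  open _≡_mod_

  ≡-mod? : ∀ a b n → Dec (a ≡ b mod n)
  ≡-mod? a b n = map′ congruent divides-difference (+ n ℤ∣.∣? a ℤ.- b)

  ≡-mod-sym : ∀ {a b n} → a ≡ b mod n → b ≡ a mod n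
  ≡-mod-sym {a} {b} (congruent n∣a-b) = congruent (subst (_ ∣ℤ_) (negate-difference a b) (ℤ∣.∣m⇒∣-m n∣a-b))
    where
    negate-difference : ∀ a b → ℤ.- (a ℤ.- b) ≡ b ℤ.- a
    negate-difference = ℤ-Ring.solve-∀

  ≡-mod-trans : ∀ {a b c n} → a ≡ b mod n → b ≡ c mod n → a ≡ c mod n
  ≡-mod-trans {a} {b} {c} (congruent n∣a-b) (congruent n∣b-c) =
    congruent (subst (_ ∣ℤ_) (telescope a b c) (ℤ∣.∣m∣n⇒∣m+n n∣a-b n∣b-c))
    where
    telescope : ∀ a b c → (a ℤ.- b) ℤ.+ (b ℤ.- c) ≡ a ℤ.- c
    telescope = ℤ-Ring.solve-∀

  ≡-mod⇒≡ : ∀ {a b p} → + a ≡ + b mod p → a < p → b < p → a ≡ b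
  ≡-mod⇒≡ {a} {b} {p} (congruent p∣a-b) a<p b<p =
    ℤ.+-injective (ℤ.i-j≡0⇒i≡j (+ a) (+ b) (ℤ.∣i∣≡0⇒i≡0 (∣⇒≡0 (ℤ∣.∣⇒∣ᵤ p∣a-b) ∣a-b∣<p)))
    where
    ∣a-b∣<p : ℤ.∣ + a ℤ.- + b ∣ < p
    ∣a-b∣<p = ≤-<-trans (∣+m-+n∣≤m⊔n a b) (ℕ.⊔-lub a<p b<p)

  -- Choosing among finitely many candidates

  unblocked-candidate : ∀ {m ℓ} (Blocks : Fin (suc m) → Fin m → Set ℓ) → (∀ t l → Dec (Blocks t l)) →
    (∀ {t₁ t₂} l → t₁ Fin.< t₂ → Blocks t₁ l → ¬ Blocks t₂ l) →
    ∃ λ t → ∀ l → ¬ Blocks t l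
  unblocked-candidate {m} Blocks blocks? blocks-once =
    decidable-stable (Fin.any? λ t → Fin.all? λ l → ¬? (blocks? t l)) ¬¬unblocked
    where
    ¬¬unblocked : ¬ ¬ ∃ λ t → ∀ l → ¬ Blocks t l
    ¬¬unblocked ¬unblocked = collide (Fin.pigeonhole (ℕ.n<1+n m) blocker)
      where
      blocked : ∀ t → ∃ (Blocks t)
      blocked t with Fin.¬∀⟶∃¬ m _ (λ l → ¬? (blocks? t l)) (λ ¬Bt → ¬unblocked (t , ¬Bt))
      ... | l , ¬¬Btl = l , decidable-stable (blocks? t l) ¬¬Btl
      blocker : Fin (suc m) → Fin m
      blocker = proj₁ ∘ blocked
      collide : (∃ λ t₁ → ∃ λ t₂ → t₁ Fin.< t₂ × blocker t₁ ≡ blocker t₂) → ⊥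
      collide (t₁ , t₂ , t₁<t₂ , same) =
        blocks-once (blocker t₁) t₁<t₂ (proj₂ (blocked t₁)) (subst (Blocks t₂) (sym same) (proj₂ (blocked t₂)))

  witnessOr : ∀ {a p} {A : Set a} {P : A → Set p} → A → Dec (∃ P) → A
  witnessOr _ (yes (x , _)) = x
  witnessOr x (no _)        = x

  witnessOr-satisfies : ∀ {a p} {A : Set a} {P : A → Set p} (x : A) (d : Dec (∃ P)) → ∃ P → P (witnessOr x d)
  witnessOr-satisfies _ (yes (_ , Px)) _  = Px
  witnessOr-satisfies _ (no ¬∃P)       ∃P = ⊥-elim (¬∃P ∃P)

  -- Exact prime divisors in a progression

  ExactPrimeDivisorAbove : ℕ → ℕ → Set
  ExactPrimeDivisorAbove B n = ∃ λ q → Prime q × B < q × q ∣ n × ¬ q * q ∣ n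

  exactPrimeDivisorAbove? : ∀ B n → Dec (ExactPrimeDivisorAbove B n)
  exactPrimeDivisorAbove? B n = map′ forget-bound add-bound (ℕ.anyUpTo? exact? (suc n))
    where
    Bounded : Set
    Bounded = ∃ λ q → q < suc n × Prime q × B < q × q ∣ n × ¬ q * q ∣ n
    exact? : ∀ q → Dec (Prime q × B < q × q ∣ n × ¬ q * q ∣ n)
    exact? q = prime? q ×-dec B ℕ.<? q ×-dec q ∣? n ×-dec ¬? (q * q ∣? n)
    forget-bound : Bounded → ExactPrimeDivisorAbove B n
    forget-bound (q , _ , exact) = q , exact
    add-bound : ExactPrimeDivisorAbove B n → Bounded
    add-bound (q , pq , B<q , q∣n , q²∤n) = q , s≤s (∣⇒≤ {{n≢0}} q∣n) , pq , B<q , q∣n , q²∤n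
      where
      n≢0 : NonZero n
      n≢0 = ℕ.≢-nonZero λ { refl → q²∤n (_ ∣0) }

  1<∣1+e*F∣ : ∀ {F} (e : ℤ) → 3 ≤ F → e ≢ 0ℤ → 1 < ℤ.∣ 1ℤ ℤ.+ e ℤ.* + F ∣
  1<∣1+e*F∣ {F} e 3≤F e≢0 = ℕ.+-cancelʳ-< 1 1 ℤ.∣ M ∣ (begin-strict
    2                <⟨ 3≤F ⟩
    F                ≤⟨ ℕ.m≤n*m F (ℤ.∣ e ∣) {{ℕ.≢-nonZero (e≢0 ∘ ℤ.∣i∣≡0⇒i≡0)}} ⟩
    ℤ.∣ e ∣ * F      ≡⟨ ℤ.abs-* e (+ F) ⟨
    ℤ.∣ e ℤ.* + F ∣  ≡⟨ cong ℤ.∣_∣ (cancel-1 e (+ F)) ⟩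
    ℤ.∣ M ℤ.- 1ℤ ∣   ≤⟨ ℤ.∣i-j∣≤∣i∣+∣j∣ M 1ℤ ⟩
    ℤ.∣ M ∣ + 1      ∎)
    where
    open ℕ.≤-Reasoning
    M : ℤ
    M = 1ℤ ℤ.+ e ℤ.* + F
    cancel-1 : ∀ e F → e ℤ.* F ≡ (1ℤ ℤ.+ e ℤ.* F) ℤ.- 1ℤ
    cancel-1 = ℤ-Ring.solve-∀

  factorial² : ℕ → ℕ
  factorial² B = B ! * B !

  prime∤factorial² : ∀ {q} B → Prime q → B < q → ¬ q ∣ factorial² B
  prime∤factorial² B pq B<q q∣B!² with euclidsLemma (B !) (B !) pq q∣B!²
  ... | inj₁ q∣B! = <⇒≱ B<q (prime∣n!⇒≤ B pq q∣B!)
  ... | inj₂ q∣B! = <⇒≱ B<q (prime∣n!⇒≤ B pq q∣B!)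

  D+F²≡D*[1+e*F] : ∀ D e F → + F ≡ e ℤ.* D → D ℤ.+ + (F * F) ≡ D ℤ.* (1ℤ ℤ.+ e ℤ.* + F)
  D+F²≡D*[1+e*F] D e F F≡e*D = begin
    D ℤ.+ + (F * F)          ≡⟨ cong (λ f → D ℤ.+ f) (ℤ.pos-* F F) ⟩
    D ℤ.+ + F ℤ.* + F        ≡⟨ cong (λ f → D ℤ.+ f ℤ.* + F) F≡e*D ⟩
    D ℤ.+ (e ℤ.* D) ℤ.* + F  ≡⟨ factor-D D e (+ F) ⟩
    D ℤ.* (1ℤ ℤ.+ e ℤ.* + F) ∎
    where
    open ≡-Reasoning
    factor-D : ∀ D e F → D ℤ.+ (e ℤ.* D) ℤ.* F ≡ D ℤ.* (1ℤ ℤ.+ e ℤ.* F)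
    factor-D = ℤ-Ring.solve-∀

  ∣1+e*F⇒∤F : ∀ {q F} (e : ℤ) → Prime q → + q ∣ℤ 1ℤ ℤ.+ e ℤ.* + F → ¬ q ∣ F
  ∣1+e*F⇒∤F {q} {F} e pq q∣1+eF q∣F = prime∤1 pq (ℤ∣.∣⇒∣ᵤ {+ q} {1ℤ}
    (ℤ∣.∣m+n∣n⇒∣m q∣1+eF (ℤ∣.∣n⇒∣m*n e (ℤ∣.∣ᵤ⇒∣ {+ q} {+ F} q∣F))))

  ∃-large-prime∣D+factorial² : ∀ {B} (D : ℤ) → 3 ≤ B → D ≢ 0ℤ → ℤ.∣ D ∣ ≤ B →
    ∃ λ q → Prime q × B < q × + q ∣ℤ D ℤ.+ + factorial² B × q ≤ ℤ.∣ D ∣ + factorial² B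
  ∃-large-prime∣D+factorial² {B} D 3≤B D≢0 ∣D∣≤B =
    from-cofactor (ℤ∣.∣ᵤ⇒∣ (∣n! (ℕ.>-nonZero⁻¹ _) ∣D∣≤B))
    where
    instance
      ∣D∣≢0 : NonZero ℤ.∣ D ∣
      ∣D∣≢0 = ℕ.≢-nonZero (D≢0 ∘ ℤ.∣i∣≡0⇒i≡0)
    F : ℕ
    F = B !
    from-cofactor : D ∣ℤ + F →
      ∃ λ q → Prime q × B < q × + q ∣ℤ D ℤ.+ + (F * F) × q ≤ ℤ.∣ D ∣ + F * F
    from-cofactor (ℤ∣.divides e F≡e*D) = q , pq , B<q , q∣D+F² , q≤∣D∣+F²
      where
      M : ℤ
      M = 1ℤ ℤ.+ e ℤ.* + F
      1<∣M∣ : 1 < ℤ.∣ M ∣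
      1<∣M∣ = 1<∣1+e*F∣ e (≤-trans 3≤B (n≤n! B))
        λ { refl → ℕ.<⇒≢ (ℕ.1≤n! B) (sym (ℤ.+-injective F≡e*D)) }
      prime-factor : ∃ λ q → Prime q × q ∣ ℤ.∣ M ∣
      prime-factor = ∃-prime-factor 1<∣M∣
      q : ℕ
      q = proj₁ prime-factor
      pq : Prime q
      pq = proj₁ (proj₂ prime-factor)
      q∣M : q ∣ ℤ.∣ M ∣
      q∣M = proj₂ (proj₂ prime-factor)
      B<q : B < q
      B<q = ℕ.≰⇒> (∣1+e*F⇒∤F e pq (ℤ∣.∣ᵤ⇒∣ q∣M) ∘ ∣n! (<-≤-trans z<s (prime>1 pq)))
      q∣D+F² : + q ∣ℤ D ℤ.+ + (F * F)
      q∣D+F² = subst (+ q ∣ℤ_) (sym (D+F²≡D*[1+e*F] D e F F≡e*D)) (ℤ∣.∣n⇒∣m*n D (ℤ∣.∣ᵤ⇒∣ q∣M))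
      q≤∣D∣+F² : q ≤ ℤ.∣ D ∣ + F * F
      q≤∣D∣+F² = begin
        q                      ≤⟨ ∣⇒≤ {{ℕ.>-nonZero (<-trans z<s 1<∣M∣)}} q∣M ⟩
        ℤ.∣ M ∣                ≤⟨ ℕ.m≤n*m _ (ℤ.∣ D ∣) ⟩
        ℤ.∣ D ∣ * ℤ.∣ M ∣      ≡⟨ ℤ.abs-* D M ⟨
        ℤ.∣ D ℤ.* M ∣          ≡⟨ cong ℤ.∣_∣ (D+F²≡D*[1+e*F] D e F F≡e*D) ⟨
        ℤ.∣ D ℤ.+ + (F * F) ∣  ≤⟨ ℤ.∣i+j∣≤∣i∣+∣j∣ D (+ (F * F)) ⟩
        ℤ.∣ D ∣ + F * F        ∎
        where open ℕ.≤-Reasoning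

  coveringPrimorial : ℕ → ℕ
  coveringPrimorial B = primeProductBelow (suc (factorial² B + B))

  -- Opaque so that unification never unfolds the factorial and the primorial inside.
  opaque
    offset : ℕ → ℕ → ℕ
    offset B t = factorial² B * suc (coveringPrimorial B * t)

    offset≡ : ∀ B t → offset B t ≡ factorial² B * suc (coveringPrimorial B * t)
    offset≡ B t = refl

  +offset≡ : ∀ B t → + offset B t ≡ + factorial² B ℤ.+ + factorial² B ℤ.* (+ coveringPrimorial B ℤ.* + t)
  +offset≡ B t = begin
    + offset B t                    ≡⟨ cong +_ (trans (offset≡ B t) (ℕ.*-suc P (L * t))) ⟩
    + (P + P * (L * t))             ≡⟨ ℤ.pos-+ P (P * (L * t)) ⟩
    + P ℤ.+ + (P * (L * t))         ≡⟨ cong (λ x → + P ℤ.+ x) (ℤ.pos-* P (L * t)) ⟩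
    + P ℤ.+ + P ℤ.* + (L * t)       ≡⟨ cong (λ x → + P ℤ.+ + P ℤ.* x) (ℤ.pos-* L t) ⟩
    + P ℤ.+ + P ℤ.* (+ L ℤ.* + t)   ∎
    where
    open ≡-Reasoning
    P L : ℕ
    P = factorial² B
    L = coveringPrimorial B

  factorial²∣offset : ∀ B t → factorial² B ∣ offset B t
  factorial²∣offset B t = subst (factorial² B ∣_) (sym (offset≡ B t)) (m∣m*n _)

  ≤offset : ∀ B t → B ≤ offset B t
  ≤offset B t = begin
    B             ≤⟨ n≤n! B ⟩
    B !           ≤⟨ ℕ.m≤m*n (B !) (B !) {{B !≢0}} ⟩
    factorial² B  ≤⟨ ℕ.m≤m*n (factorial² B) (suc _) ⟩
    _             ≡⟨ offset≡ B t ⟨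
    offset B t    ∎
    where open ℕ.≤-Reasoning

  ∣offset-difference∣ : ∀ B (D : ℤ) t₁ t₂ →
    ℤ.∣ (D ℤ.+ + offset B t₂) ℤ.- (D ℤ.+ + offset B t₁) ∣
      ≡ factorial² B * (coveringPrimorial B * ℤ.∣ + t₂ ℤ.- + t₁ ∣)
  ∣offset-difference∣ B D t₁ t₂ = begin
    ℤ.∣ (D ℤ.+ + offset B t₂) ℤ.- (D ℤ.+ + offset B t₁) ∣
      ≡⟨ cong₂ (λ a b → ℤ.∣ (D ℤ.+ a) ℤ.- (D ℤ.+ b) ∣) (+offset≡ B t₂) (+offset≡ B t₁) ⟩
    ℤ.∣ (D ℤ.+ (+ P ℤ.+ + P ℤ.* (+ L ℤ.* + t₂))) ℤ.- (D ℤ.+ (+ P ℤ.+ + P ℤ.* (+ L ℤ.* + t₁))) ∣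
      ≡⟨ cong ℤ.∣_∣ (difference D (+ P) (+ L) (+ t₁) (+ t₂)) ⟩
    ℤ.∣ + P ℤ.* (+ L ℤ.* (+ t₂ ℤ.- + t₁)) ∣
      ≡⟨ trans (ℤ.abs-* (+ P) _) (cong (P *_) (ℤ.abs-* (+ L) _)) ⟩
    P * (L * ℤ.∣ + t₂ ℤ.- + t₁ ∣)
      ∎
    where
    open ≡-Reasoning
    P L : ℕ
    P = factorial² B
    L = coveringPrimorial B
    difference : ∀ D P L t₁ t₂ → (D ℤ.+ (P ℤ.+ P ℤ.* (L ℤ.* t₂))) ℤ.- (D ℤ.+ (P ℤ.+ P ℤ.* (L ℤ.* t₁)))
                                 ≡ P ℤ.* (L ℤ.* (t₂ ℤ.- t₁))
    difference = ℤ-Ring.solve-∀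

  record ControllingPrime (B : ℕ) (D : ℤ) (q : ℕ) : Set where
    field
      prime       : Prime q
      large       : B < q
      divides-all : ∀ t → q ∣ ℤ.∣ D ℤ.+ + offset B t ∣
      square-once : ∀ {t₁ t₂} → t₁ < t₂ → t₂ ≤ B →
                    q * q ∣ ℤ.∣ D ℤ.+ + offset B t₁ ∣ → ¬ q * q ∣ ℤ.∣ D ℤ.+ + offset B t₂ ∣

  ∃-controllingPrime : ∀ {B} (D : ℤ) → 3 ≤ B → D ≢ 0ℤ → ℤ.∣ D ∣ ≤ B → ∃ (ControllingPrime B D)
  ∃-controllingPrime {B} D 3≤B D≢0 ∣D∣≤B =
    from-large-prime (∃-large-prime∣D+factorial² D 3≤B D≢0 ∣D∣≤B)
    where
    P L : ℕ
    P = factorial² B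
    L = coveringPrimorial B
    from-large-prime : (∃ λ q → Prime q × B < q × + q ∣ℤ D ℤ.+ + P × q ≤ ℤ.∣ D ∣ + P) →
                       ∃ (ControllingPrime B D)
    from-large-prime (q , pq , B<q , q∣D+P , q≤∣D∣+P) = q , record
      { prime = pq ; large = B<q ; divides-all = q∣term ; square-once = square-once }
      where
      q∣L : q ∣ L
      q∣L = ∣primeProductBelow (suc (P + B)) pq (s≤s (begin
        q              ≤⟨ q≤∣D∣+P ⟩
        ℤ.∣ D ∣ + P    ≤⟨ ℕ.+-monoˡ-≤ P ∣D∣≤B ⟩
        B + P          ≡⟨ ℕ.+-comm B P ⟩
        P + B          ∎))
        where open ℕ.≤-Reasoning
      q∣term : ∀ t → q ∣ ℤ.∣ D ℤ.+ + offset B t ∣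
      q∣term t = ℤ∣.∣⇒∣ᵤ (subst (_ ∣ℤ_) (sym term≡)
        (ℤ∣.∣m∣n⇒∣m+n q∣D+P (ℤ∣.∣n⇒∣m*n (+ P) (ℤ∣.∣m⇒∣m*n (+ t) (ℤ∣.∣ᵤ⇒∣ {+ q} {+ L} q∣L)))))
        where
        term≡ : D ℤ.+ + offset B t ≡ (D ℤ.+ + P) ℤ.+ + P ℤ.* (+ L ℤ.* + t)
        term≡ = trans (cong (λ x → D ℤ.+ x) (+offset≡ B t)) (sym (ℤ.+-assoc D (+ P) _))
      square-once : ∀ {t₁ t₂} → t₁ < t₂ → t₂ ≤ B →
                    q * q ∣ ℤ.∣ D ℤ.+ + offset B t₁ ∣ → ¬ q * q ∣ ℤ.∣ D ℤ.+ + offset B t₂ ∣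
      -- The two terms differ by P L (t₂ − t₁); q divides neither P nor t₂ − t₁, and L is squarefree.
      square-once {t₁} {t₂} t₁<t₂ t₂≤B q²∣term₁ q²∣term₂ =
        primeProductBelow-squarefree (suc (P + B)) pq q²∣L
        where
        d : ℕ
        d = ℤ.∣ + t₂ ℤ.- + t₁ ∣
        q∤d : ¬ q ∣ d
        q∤d q∣d = ℕ.<⇒≢ t₁<t₂ (sym (ℤ.+-injective (ℤ.i-j≡0⇒i≡j (+ t₂) (+ t₁)
          (ℤ.∣i∣≡0⇒i≡0 (∣⇒≡0 q∣d (≤-<-trans d≤t₂ (≤-<-trans t₂≤B B<q)))))))
          where
          d≤t₂ : d ≤ t₂
          d≤t₂ = ≤-trans (∣+m-+n∣≤m⊔n t₂ t₁) (ℕ.≤-reflexive (ℕ.m≥n⇒m⊔n≡m (<⇒≤ t₁<t₂)))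
        q²∣P*L*d : q * q ∣ P * (L * d)
        q²∣P*L*d = subst (q * q ∣_) (∣offset-difference∣ B D t₁ t₂)
          (ℤ∣.∣⇒∣ᵤ (ℤ∣.∣m∣n⇒∣m-n (ℤ∣.∣ᵤ⇒∣ {+ (q * q)} {D ℤ.+ + offset B t₂} q²∣term₂)
                                  (ℤ∣.∣ᵤ⇒∣ {+ (q * q)} {D ℤ.+ + offset B t₁} q²∣term₁)))
        q²∣L : q * q ∣ L
        q²∣L = prime²∣m*n⇒prime²∣n d L pq q∤d (subst (q * q ∣_) (ℕ.*-comm L d)
          (prime²∣m*n⇒prime²∣n P (L * d) pq (prime∤factorial² B pq B<q) q²∣P*L*d))

  ∃-exact-candidate : ∀ {B m} → 3 ≤ B → m ≤ B →
    (D : Fin m → ℤ) → (∀ l → D l ≢ 0ℤ) → (∀ l → ℤ.∣ D l ∣ ≤ B) →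
    ∃ λ (t : Fin (suc m)) → ∀ l → ExactPrimeDivisorAbove B ℤ.∣ D l ℤ.+ + offset B (toℕ t) ∣
  ∃-exact-candidate {B} {m} 3≤B m≤B D D≢0 ∣D∣≤B = map₂ exact (unblocked-candidate Blocks blocks? blocks-once)
    where
    prime-of : ∀ l → ∃ (ControllingPrime B (D l))
    prime-of l = ∃-controllingPrime (D l) 3≤B (D≢0 l) (∣D∣≤B l)
    q : Fin m → ℕ
    q l = proj₁ (prime-of l)
    Blocks : Fin (suc m) → Fin m → Set
    Blocks t l = q l * q l ∣ ℤ.∣ D l ℤ.+ + offset B (toℕ t) ∣
    blocks? : ∀ t l → Dec (Blocks t l)
    blocks? t l = _ ∣? _
    blocks-once : ∀ {t₁ t₂} l → t₁ Fin.< t₂ → Blocks t₁ l → ¬ Blocks t₂ l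
    blocks-once {t₂ = t₂} l t₁<t₂ =
      ControllingPrime.square-once (proj₂ (prime-of l)) t₁<t₂ (≤-trans (ℕ.≤-pred (Fin.toℕ<n t₂)) m≤B)
    exact : ∀ {t} → (∀ l → ¬ Blocks t l) →
            ∀ l → ExactPrimeDivisorAbove B ℤ.∣ D l ℤ.+ + offset B (toℕ t) ∣
    exact {t} unblocked l = let (q , controlling) = prime-of l in
      q , ControllingPrime.prime controlling , ControllingPrime.large controlling ,
      ControllingPrime.divides-all controlling (toℕ t) , unblocked l

  GoodCandidate : ℕ → ℕ → ∀ {m} → (Fin m → ℕ) → Fin (suc m) → Set
  GoodCandidate B j g t = ∀ l → ExactPrimeDivisorAbove B ℤ.∣ (+ j ℤ.- + g l) ℤ.+ + offset B (toℕ t) ∣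

  goodCandidate? : ∀ B j {m} (g : Fin m → ℕ) t → Dec (GoodCandidate B j g t)
  goodCandidate? B j g t = Fin.all? λ l → exactPrimeDivisorAbove? B _

  -- Falls back to t = 0 if no candidate is good; nextTerm-exact shows this cannot happen.
  chosenCandidate : ℕ → ℕ → ∀ {m} → (Fin m → ℕ) → Fin (suc m)
  chosenCandidate B j g = witnessOr Fin.zero (Fin.any? (goodCandidate? B j g))

  nextTerm : ℕ → ℕ → ∀ {m} → (Fin m → ℕ) → ℕ
  nextTerm B j g = j + offset B (toℕ (chosenCandidate B j g))

  nextTerm-exact : ∀ {B j m} (g : Fin m → ℕ) → 3 ≤ B → m ≤ B → j ≤ B →
    (∀ l → g l ≤ B) → (∀ l → g l ≢ j) →
    ∀ l → ExactPrimeDivisorAbove B ℤ.∣ + nextTerm B j g ℤ.- + g l ∣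
  nextTerm-exact {B} {j} {m} g 3≤B m≤B j≤B g≤B g≢j l =
    subst (ExactPrimeDivisorAbove B ∘ ℤ.∣_∣) (regroup (offset B (toℕ (chosenCandidate B j g))))
      (witnessOr-satisfies Fin.zero (Fin.any? (goodCandidate? B j g)) (∃-exact-candidate 3≤B m≤B D D≢0 ∣D∣≤B) l)
    where
    D : Fin m → ℤ
    D l = + j ℤ.- + g l
    D≢0 : ∀ l → D l ≢ 0ℤ
    D≢0 l D≡0 = g≢j l (sym (ℤ.+-injective (ℤ.i-j≡0⇒i≡j (+ j) (+ g l) D≡0)))
    ∣D∣≤B : ∀ l → ℤ.∣ D l ∣ ≤ B
    ∣D∣≤B l = ≤-trans (∣+m-+n∣≤m⊔n j (g l)) (ℕ.⊔-lub j≤B (g≤B l))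
    regroup : ∀ o → (+ j ℤ.- + g l) ℤ.+ + o ≡ + (j + o) ℤ.- + g l
    regroup o = trans (move (+ j) (+ g l) (+ o)) (cong (ℤ._- + g l) (sym (ℤ.pos-+ j o)))
      where
      move : ∀ a b c → (a ℤ.- b) ℤ.+ c ≡ (a ℤ.+ c) ℤ.- b
      move = ℤ-Ring.solve-∀

  -- Admissibility

  admissible-if : ∀ {k} (h : Fin k → ℤ) →
    (∀ p → Prime p → k < p ⊎ (∀ i → p ∣ ℤ.∣ h i ∣)) → Admissible h
  admissible-if {k} h large-or-common p pp with large-or-common p pp
  ... | inj₂ p∣h = 1ℤ , λ i p∣1-h → prime∤1 pp (ℤ∣.∣⇒∣ᵤ {+ p} {1ℤ}
          (subst (_ ∣ℤ_) (cancel 1ℤ (h i))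
            (ℤ∣.∣m∣n⇒∣m+n (ℤ∣.∣ᵤ⇒∣ {+ p} {1ℤ ℤ.- h i} p∣1-h) (ℤ∣.∣ᵤ⇒∣ {+ p} {h i} (p∣h i)))))
    where
    cancel : ∀ a b → (a ℤ.- b) ℤ.+ b ≡ a
    cancel = ℤ-Ring.solve-∀
  ... | inj₁ k<p = let (n , unblocked) = unblocked-candidate Blocks blocks? blocks-once in + toℕ n , unblocked
    where
    Blocks : Fin (suc k) → Fin k → Set
    Blocks n i = p ∣ ℤ.∣ + toℕ n ℤ.- h i ∣
    blocks? : ∀ n i → Dec (Blocks n i)
    blocks? n i = _ ∣? _
    blocks-once : ∀ {n₁ n₂} i → n₁ Fin.< n₂ → Blocks n₁ i → ¬ Blocks n₂ i
    blocks-once {n₁} {n₂} i n₁<n₂ p∣n₁-h p∣n₂-h = ℕ.<⇒≢ n₁<n₂ (≡-mod⇒≡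
      (≡-mod-trans (congruent {b = h i} (ℤ∣.∣ᵤ⇒∣ p∣n₁-h))
                   (≡-mod-sym (congruent {b = h i} (ℤ∣.∣ᵤ⇒∣ p∣n₂-h))))
      (<-≤-trans (Fin.toℕ<n n₁) k<p) (<-≤-trans (Fin.toℕ<n n₂) k<p))

  -- The sequence z

  step-increasing⇒strictMono : ∀ (f : ℕ → ℕ) → (∀ n → f n < f (suc n)) → ∀ {i j} → i < j → f i < f j
  step-increasing⇒strictMono f f-suc {i} {suc j} (s≤s i≤j) with ℕ.m≤n⇒m<n∨m≡n i≤j
  ... | inj₁ i<j  = <-trans (step-increasing⇒strictMono f f-suc i<j) (f-suc j)
  ... | inj₂ refl = f-suc i

  step-increasing⇒mono : ∀ (f : ℕ → ℕ) → (∀ n → f n < f (suc n)) → ∀ {i j} → i ≤ j → f i ≤ f j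
  step-increasing⇒mono f f-suc i≤j with ℕ.m≤n⇒m<n∨m≡n i≤j
  ... | inj₁ i<j  = <⇒≤ (step-increasing⇒strictMono f f-suc i<j)
  ... | inj₂ refl = ≤-refl

  extendAt : ℕ → (ℕ → ℕ) → ℕ → ℕ → ℕ
  extendAt n g v i with i ℕ.≤? n
  ... | yes _ = g i
  ... | no _  = v

  extendAt-≤ : ∀ {i n} g v → i ≤ n → extendAt n g v i ≡ g i
  extendAt-≤ {i} {n} g v i≤n with i ℕ.≤? n
  ... | yes _  = refl
  ... | no i≰n = ⊥-elim (i≰n i≤n)

  extendAt-suc : ∀ n g v → extendAt n g v (suc n) ≡ v
  extendAt-suc n g v with suc n ℕ.≤? n
  ... | yes 1+n≤n = ⊥-elim (ℕ.1+n≰n 1+n≤n)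
  ... | no _      = refl

  module Sequence (c : ℕ) where

    bound : ℕ → ℕ
    bound x = x + c + 3

    step : ℕ → (ℕ → ℕ) → ℕ
    step n g = nextTerm (bound (g n)) (suc n) (g ∘ toℕ {suc n})

    -- stages n agrees with z on 0, …, n; its values beyond n are junk.
    stages : ℕ → ℕ → ℕ
    stages zero    = λ _ → 0
    stages (suc n) = extendAt n (stages n) (step n (stages n))

    z : ℕ → ℕ
    z n = stages n n

    stages-stable : ∀ {i n} → i ≤ n → stages n i ≡ z i
    stages-stable {n = zero} z≤n = refl
    stages-stable {i} {suc n} i≤1+n with ℕ.m≤n⇒m<n∨m≡n i≤1+n
    ... | inj₁ (s≤s i≤n) = trans (extendAt-≤ (stages n) _ i≤n) (stages-stable i≤n)
    ... | inj₂ refl      = refl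

    z-suc≡step : ∀ n → z (suc n) ≡ step n (stages n)
    z-suc≡step n = extendAt-suc n (stages n) (step n (stages n))

    z-suc : ∀ n → ∃ λ t → z (suc n) ≡ suc n + offset (bound (z n)) t
    z-suc n = _ , z-suc≡step n

    bound≤z-suc : ∀ n → bound (z n) ≤ z (suc n)
    bound≤z-suc n = let (t , z[n+1]≡) = z-suc n in
      ≤-trans (≤-trans (≤offset (bound (z n)) t) (ℕ.m≤n+m _ (suc n))) (ℕ.≤-reflexive (sym z[n+1]≡))

    <bound : ∀ x → x < bound x
    <bound x = ≤-<-trans (ℕ.m≤m+n x c) (ℕ.m<m+n (x + c) z<s)

    c<bound : ∀ x → c < bound x
    c<bound x = ≤-<-trans (ℕ.m≤n+m c x) (ℕ.m<m+n (x + c) z<s)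

    z-increasing : ∀ n → z n < z (suc n)
    z-increasing n = <-≤-trans (<bound (z n)) (bound≤z-suc n)

    c<z-suc : ∀ n → c < z (suc n)
    c<z-suc n = <-≤-trans (c<bound (z n)) (bound≤z-suc n)

    z-suc≡ : ∀ {p} n → 0 < p → p ≤ bound (z n) → + z (suc n) ≡ + suc n mod p
    z-suc≡ {p} n 0<p p≤B = let (t , z[n+1]≡) = z-suc n in
      subst (λ x → + x ≡ + suc n mod p) (sym z[n+1]≡) (congruent
        (ℤ∣.∣ᵤ⇒∣ (subst (p ∣_) (cong ℤ.∣_∣ (sym (+[m+n]-+m (suc n) _)))
          (∣-trans (∣n! 0<p p≤B) (∣-trans (m∣m*n _) (factorial²∣offset _ t))))))

    z-monotone : ∀ {i j} → i ≤ j → z i ≤ z j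
    z-monotone = step-increasing⇒mono z z-increasing

    z≢index : ∀ {i j} → 0 < j → j ≤ c → z i ≢ j
    z≢index {zero}  0<j _   z0≡j  = ℕ.<⇒≢ 0<j z0≡j
    z≢index {suc i} _   j≤c zi≡j = <⇒≱ (c<z-suc i) (subst (_≤ c) (sym zi≡j) j≤c)

    z-exact : ∀ {l j} → l < j → j ≤ c → ExactPrimeDivisorAbove c ℤ.∣ + z j ℤ.- + z l ∣
    z-exact {l} {suc n} (s≤s l≤n) 1+n≤c =
      let (q , pq , B<q , q∣d , q²∤d) = subst₂ (λ a b → ExactPrimeDivisorAbove B ℤ.∣ + a ℤ.- + b ∣)
            (sym (z-suc≡step n)) g[l]≡z[l]
            (nextTerm-exact g (ℕ.m≤n+m 3 (z n + c)) 1+n≤B 1+n≤B g≤B g≢1+n (Fin.fromℕ< (s≤s l≤n)))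
      in q , pq , <-trans (c<bound (z n)) B<q , q∣d , q²∤d
      where
      B : ℕ
      B = bound (z n)
      g : Fin (suc n) → ℕ
      g = stages n ∘ toℕ
      1+n≤B : suc n ≤ B
      1+n≤B = <⇒≤ (≤-<-trans 1+n≤c (c<bound (z n)))
      g≡z : ∀ i → g i ≡ z (toℕ i)
      g≡z i = stages-stable {toℕ i} (ℕ.≤-pred (Fin.toℕ<n i))
      g[l]≡z[l] : g (Fin.fromℕ< (s≤s l≤n)) ≡ z l
      g[l]≡z[l] = trans (g≡z _) (cong z (Fin.toℕ-fromℕ< (s≤s l≤n)))
      g≤B : ∀ i → g i ≤ B
      g≤B i = ≤-trans (ℕ.≤-reflexive (g≡z i))
        (≤-trans (z-monotone (ℕ.≤-pred (Fin.toℕ<n i))) (<⇒≤ (<bound (z n))))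
      g≢1+n : ∀ i → g i ≢ suc n
      g≢1+n i g≡ = z≢index {toℕ i} z<s 1+n≤c (trans (sym (g≡z i)) g≡)

  -- Collisions modulo a large prime

  module Collision (c : ℕ) (z : ℕ → ℕ) (z-zero : z 0 ≡ 0) (z-increasing : ∀ n → z n < z (suc n))
                   (c<z-suc : ∀ n → c < z (suc n)) (p : ℕ) (c<p : c < p)
                   (z-suc≡ : ∀ n → p ≤ z n → + z (suc n) ≡ + suc n mod p) where

    Tame : ℕ → Set
    Tame i = z i < p ⊎ + z i ≡ + i mod p

    tame? : ∀ i → Dec (Tame i)
    tame? i = z i ℕ.<? p ⊎-dec ≡-mod? (+ z i) (+ i) p

    z-injective : ∀ {i j} → z i ≡ z j → i ≡ j
    z-injective {i} {j} zi≡zj with ℕ.<-cmp i j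
    ... | tri< i<j _ _ = ⊥-elim (ℕ.<⇒≢ (step-increasing⇒strictMono z z-increasing i<j) zi≡zj)
    ... | tri≈ _ i≡j _ = i≡j
    ... | tri> _ _ j<i = ⊥-elim (ℕ.<⇒≢ (step-increasing⇒strictMono z z-increasing j<i) (sym zi≡zj))

    z≤c⇒≡0 : ∀ {i} → z i ≤ c → i ≡ 0
    z≤c⇒≡0 {zero}  _     = refl
    z≤c⇒≡0 {suc i} zi≤c = ⊥-elim (<⇒≱ (c<z-suc i) zi≤c)

    small-≡-index : ∀ {i j} → z i < p → + z i ≡ + j mod p → j ≤ c → i ≡ j
    small-≡-index {i} {j} zi<p zi≡j j≤c = trans i≡0 (trans (sym z-zero) (trans (cong z (sym i≡0)) zi≡j′))
      where
      zi≡j′ : z i ≡ j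
      zi≡j′ = ≡-mod⇒≡ zi≡j zi<p (≤-<-trans j≤c c<p)
      i≡0 : i ≡ 0
      i≡0 = z≤c⇒≡0 (subst (_≤ c) (sym zi≡j′) j≤c)

    tame-injective : ∀ {i j} → i ≤ c → j ≤ c → Tame i → Tame j → + z i ≡ + z j mod p → i ≡ j
    tame-injective _   _   (inj₁ zi<p) (inj₁ zj<p) zi≡zj = z-injective (≡-mod⇒≡ zi≡zj zi<p zj<p)
    tame-injective i≤c j≤c (inj₂ zi≡i) (inj₂ zj≡j) zi≡zj =
      ≡-mod⇒≡ (≡-mod-trans (≡-mod-sym zi≡i) (≡-mod-trans zi≡zj zj≡j)) (≤-<-trans i≤c c<p) (≤-<-trans j≤c c<p)
    tame-injective _   j≤c (inj₁ zi<p) (inj₂ zj≡j) zi≡zj = small-≡-index zi<p (≡-mod-trans zi≡zj zj≡j) j≤c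
    tame-injective i≤c _   (inj₂ zi≡i) (inj₁ zj<p) zi≡zj =
      sym (small-≡-index zj<p (≡-mod-trans (≡-mod-sym zi≡zj) zi≡i) i≤c)

    untame⇒suc : ∀ {i} → ¬ Tame i → ∃ λ n → i ≡ suc n × z n < p
    untame⇒suc {zero}  ¬tame = ⊥-elim (¬tame (inj₁ (subst (_< p) (sym z-zero) (≤-<-trans z≤n c<p))))
    untame⇒suc {suc n} ¬tame = n , refl , ℕ.≰⇒> (¬tame ∘ inj₂ ∘ z-suc≡ n)

    untame-ordered : ∀ {i j} → ¬ Tame i → ¬ Tame j → ¬ i < j
    untame-ordered ¬tame-i ¬tame-j i<j with untame⇒suc ¬tame-j
    ... | n , refl , zn<p = ¬tame-i (inj₁ (≤-<-trans (step-increasing⇒mono z z-increasing (ℕ.≤-pred i<j)) zn<p))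

    untame-unique : ∀ {i j} → ¬ Tame i → ¬ Tame j → i ≡ j
    untame-unique {i} {j} ¬tame-i ¬tame-j with ℕ.<-cmp i j
    ... | tri< i<j _ _ = ⊥-elim (untame-ordered ¬tame-i ¬tame-j i<j)
    ... | tri≈ _ i≡j _ = i≡j
    ... | tri> _ _ j<i = ⊥-elim (untame-ordered ¬tame-j ¬tame-i j<i)

    untame-member : ∀ {i j} → i ≢ j → i ≤ c → j ≤ c → + z j ≡ + z i mod p → ¬ Tame i ⊎ ¬ Tame j
    untame-member {i} {j} i≢j i≤c j≤c zj≡zi with tame? i | tame? j
    ... | no ¬tame-i | _          = inj₁ ¬tame-i
    ... | yes _      | no ¬tame-j = inj₂ ¬tame-j
    ... | yes tame-i | yes tame-j = ⊥-elim (i≢j (tame-injective i≤c j≤c tame-i tame-j (≡-mod-sym zj≡zi)))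

    partners-unique : ∀ {σ σ′ u v} → ¬ Tame σ → ¬ Tame σ′ → u ≤ c → v ≤ c → u ≢ σ → v ≢ σ′ →
                      + z u ≡ + z σ mod p → + z v ≡ + z σ′ mod p → u ≡ v
    partners-unique {σ} {σ′} ¬tame-σ ¬tame-σ′ u≤c v≤c u≢σ v≢σ′ zu≡zσ zv≡zσ′ =
      tame-injective u≤c v≤c (tame ¬tame-σ u≢σ) (tame ¬tame-σ′ v≢σ′)
        (≡-mod-trans zu≡zσ (subst (λ x → + z x ≡ + z _ mod p) (sym σ≡σ′) (≡-mod-sym zv≡zσ′)))
      where
      σ≡σ′ : σ ≡ σ′
      σ≡σ′ = untame-unique ¬tame-σ ¬tame-σ′
      tame : ∀ {w τ} → ¬ Tame τ → w ≢ τ → Tame w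
      tame {w} ¬tame-τ w≢τ = decidable-stable (tame? w) (λ ¬tame-w → w≢τ (untame-unique ¬tame-w ¬tame-τ))

    collision : ∀ {i j s t} → i < j → j ≤ c → s < t → t ≤ c →
                + z j ≡ + z i mod p → + z t ≡ + z s mod p → i ≡ s × j ≡ t
    collision {i} {j} {s} {t} i<j j≤c s<t t≤c zj≡zi zt≡zs =
      from-untame (untame-member i≢j i≤c j≤c zj≡zi) (untame-member s≢t s≤c t≤c zt≡zs)
      where
      i≢j : i ≢ j
      i≢j = ℕ.<⇒≢ i<j
      s≢t : s ≢ t
      s≢t = ℕ.<⇒≢ s<t
      i≤c : i ≤ c
      i≤c = <⇒≤ (<-≤-trans i<j j≤c)
      s≤c : s ≤ c
      s≤c = <⇒≤ (<-≤-trans s<t t≤c)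
      from-untame : ¬ Tame i ⊎ ¬ Tame j → ¬ Tame s ⊎ ¬ Tame t → i ≡ s × j ≡ t
      from-untame (inj₁ ¬tame-i) (inj₁ ¬tame-s) =
        untame-unique ¬tame-i ¬tame-s ,
        partners-unique ¬tame-i ¬tame-s j≤c t≤c (i≢j ∘ sym) (s≢t ∘ sym) zj≡zi zt≡zs
      from-untame (inj₂ ¬tame-j) (inj₂ ¬tame-t) =
        partners-unique ¬tame-j ¬tame-t i≤c s≤c i≢j s≢t (≡-mod-sym zj≡zi) (≡-mod-sym zt≡zs) ,
        untame-unique ¬tame-j ¬tame-t
      from-untame (inj₁ ¬tame-i) (inj₂ ¬tame-t) = ⊥-elim (<-irrefl refl (begin-strict
        s  <⟨ s<t ⟩
        t  ≡⟨ untame-unique ¬tame-t ¬tame-i ⟩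
        i  <⟨ i<j ⟩
        j  ≡⟨ partners-unique ¬tame-i ¬tame-t j≤c s≤c (i≢j ∘ sym) s≢t zj≡zi (≡-mod-sym zt≡zs) ⟩
        s  ∎))
        where open ℕ.≤-Reasoning
      from-untame (inj₂ ¬tame-j) (inj₁ ¬tame-s) = ⊥-elim (<-irrefl refl (begin-strict
        i  <⟨ i<j ⟩
        j  ≡⟨ untame-unique ¬tame-j ¬tame-s ⟩
        s  <⟨ s<t ⟩
        t  ≡⟨ partners-unique ¬tame-s ¬tame-j t≤c i≤c (s≢t ∘ sym) i≢j zt≡zs (≡-mod-sym zj≡zi) ⟩
        i  ∎))
        where open ℕ.≤-Reasoning

  module Tuple (k : ℕ) (1<k : 1 < k) where

    c : ℕ
    c = 4 * k

    K : ℕ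
    K = 4 * primeProductBelow c

    open Sequence c

    h : Fin k → ℤ
    h i = + (K * z (toℕ i))

    instance
      K≢0 : NonZero K
      K≢0 = ℕ.>-nonZero (ℕ.*-mono-≤ {1} {4} (s≤s z≤n) (primeProductBelow>0 c))

    k<c : k < c
    k<c = subst (k <_) (ℕ.*-comm k 4) (ℕ.m<m*n k 4 {{ℕ.>-nonZero (<-trans z<s 1<k)}} (s≤s (s≤s z≤n)))

    toℕ≤c : ∀ (i : Fin k) → toℕ i ≤ c
    toℕ≤c i = <⇒≤ (<-trans (Fin.toℕ<n i) k<c)

    prime∤K : ∀ {q} → Prime q → c < q → ¬ q ∣ K
    prime∤K {q} pq c<q q∣K with euclidsLemma 4 (primeProductBelow c) pq q∣K
    ... | inj₁ q∣4 = <⇒≱ (≤-<-trans (ℕ.m≤m*n 4 k {{ℕ.>-nonZero (<-trans z<s 1<k)}}) c<q) (∣⇒≤ q∣4)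
    ... | inj₂ q∣∏ = <⇒≱ c<q (<⇒≤ (prime∣primeProductBelow⇒< c pq q∣∏))

    ∣h-h∣ : ∀ i j → ℤ.∣ h i ℤ.- h j ∣ ≡ K * ℤ.∣ + z (toℕ j) ℤ.- + z (toℕ i) ∣
    ∣h-h∣ i j = ∣+[k*a]-+[k*b]∣ K (z (toℕ i)) (z (toℕ j))

    h-admissible : Admissible h
    h-admissible = admissible-if h large-or-common
      where
      large-or-common : ∀ p → Prime p → k < p ⊎ (∀ i → p ∣ ℤ.∣ h i ∣)
      large-or-common p pp with p ℕ.≤? k
      ... | no p≰k  = inj₁ (ℕ.≰⇒> p≰k)
      ... | yes p≤k = inj₂ λ i →
        ∣-trans (∣n⇒∣m*n 4 (∣primeProductBelow c pp (≤-<-trans p≤k k<c))) (m∣m*n (z (toℕ i)))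

    h-zero : ∀ i → toℕ i ≡ 0 → h i ≡ + 0
    h-zero i i≡0 = cong +_ (trans (cong (λ n → K * z n) i≡0) (ℕ.*-zeroʳ K))

    h-increasing : ∀ i j → i Fin.< j → h i ℤ.< h j
    h-increasing i j i<j = ℤ.+<+ (ℕ.*-monoʳ-< K (step-increasing⇒strictMono z z-increasing i<j))

    K∣h : ∀ i → K ∣ ℤ.∣ h i ∣
    K∣h i = m∣m*n (z (toℕ i))

    h-exact : ∀ i j → i Fin.< j →
      ∃ λ p → Prime p × c < p × p ∣ ℤ.∣ h i ℤ.- h j ∣ × ¬ p ^ 2 ∣ ℤ.∣ h i ℤ.- h j ∣
    h-exact i j i<j = let (q , pq , c<q , q∣d , q²∤d) = z-exact i<j (toℕ≤c j) in
      q , pq , c<q , subst (q ∣_) (sym (∣h-h∣ i j)) (∣n⇒∣m*n K q∣d) ,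
      λ q^2∣Kd → q²∤d (prime²∣m*n⇒prime²∣n K _ pq (prime∤K pq c<q)
        (subst₂ _∣_ (cong (q *_) (ℕ.*-identityʳ q)) (∣h-h∣ i j) q^2∣Kd))

    h-collision-free : ∀ i j s t → i Fin.< j → s Fin.< t →
      ¬ ((i ≡ s × j ≡ t) ⊎ (i ≡ t × j ≡ s)) →
      ∀ p → Prime p → c < p → ¬ (p ∣ ℤ.∣ h i ℤ.- h j ∣ × p ∣ ℤ.∣ h s ℤ.- h t ∣)
    h-collision-free i j s t i<j s<t distinct p pp c<p (p∣hi-hj , p∣hs-ht) =
      let (i≡s , j≡t) = collision i<j (toℕ≤c j) s<t (toℕ≤c t)
                          (congruence {i} {j} p∣hi-hj) (congruence {s} {t} p∣hs-ht) in
      distinct (inj₁ (Fin.toℕ-injective i≡s , Fin.toℕ-injective j≡t))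
      where
      z-suc≡-large : ∀ n → p ≤ z n → + z (suc n) ≡ + suc n mod p
      z-suc≡-large n p≤zn = z-suc≡ n (<-trans z<s (prime>1 pp)) (≤-trans p≤zn (<⇒≤ (<bound (z n))))
      open Collision c z refl z-increasing c<z-suc p c<p z-suc≡-large
      congruence : ∀ {a b} → p ∣ ℤ.∣ h a ℤ.- h b ∣ → + z (toℕ b) ≡ + z (toℕ a) mod p
      congruence {a} {b} p∣ha-hb with euclidsLemma K _ pp (subst (p ∣_) (∣h-h∣ a b) p∣ha-hb)
      ... | inj₁ p∣K = ⊥-elim (prime∤K pp c<p p∣K)
      ... | inj₂ p∣d = congruent (ℤ∣.∣ᵤ⇒∣ p∣d)

open import Defs
open import Data.Nat using (ℕ; _*_; _^_)
open import Data.Nat.Primality using (Prime)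
open import Data.Fin using (Fin; toℕ)
open import Data.Product using (Σ; ∃; _×_; _,_)
open import Data.Sum using (_⊎_)
open import Data.Integer as ℤ using (ℤ; +_)
open import Data.Integer.Divisibility using (_∣_)
open import Relation.Nullary using (¬_)
open import Relation.Binary.PropositionalEquality using (_≡_)
open Construction using (module Tuple)

lemma3p1 : (k : ℕ) → 1 Data.Nat.< k →
    Σ (Fin k → ℤ) λ h →
      Admissible h
      × (∀ (i : Fin k) → toℕ i ≡ 0 → h i ≡ + 0)
      × (∀ (i j : Fin k) → i Data.Fin.< j → h i ℤ.< h j)
      × (∀ (i : Fin k) → (+ (4 * primeProductBelow (4 * k))) ∣ h i)
      × (∀ (i j : Fin k) → i Data.Fin.< j →
           ∃ λ (p : ℕ) → Prime p × (4 * k) Data.Nat.< p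
             × (+ p) ∣ (h i ℤ.- h j) × ¬ ((+ (p ^ 2)) ∣ (h i ℤ.- h j)))
      × (∀ (i j s t : Fin k) → i Data.Fin.< j → s Data.Fin.< t →
           ¬ ((i ≡ s × j ≡ t) ⊎ (i ≡ t × j ≡ s)) →
           ∀ (p : ℕ) → Prime p → (4 * k) Data.Nat.< p →
           ¬ ((+ p) ∣ (h i ℤ.- h j) × (+ p) ∣ (h s ℤ.- h t)))
lemma3p1 k 1<k = h , h-admissible , h-zero , h-increasing , K∣h , h-exact , h-collision-free
  where open Tuple k 1<k
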